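{- Let $M$ be a matroid of dimension at least $2$. Then $M\in\mathcal E_3$ if and only if $M$ arises from a $2$-dimensional matroid by a sequence of doublings and/or semidoublings.
   Context: A simple binary matroid (here just "matroid") is a pair $M=(E,G)$, where $G$ is identified with $\mathbb F_2^n\setminus\{0\}$ and $E\subseteq G$; $\dim(M)=n$. A flat of $G$ is a set $V\setminus\{0\}$ with $V$ a subspace, of dimension $\dim V$; a hyperplane is a flat of dimension $n-1$. $\mathcal E_3$ is the class of matroids $(E,G)$ with $|E\cap F|$ even for every flat $F$ of dimension at least $3$. Given a matroid $M_0=(E_0,G_0)$, let $G$ be a projective geometry containing $G_0$ as a hyperplane and $w\in G\setminus G_0$. The doubling of $M_0$ (by $w$) is $(E_0\cup\{w+x:x\in E_0\},G)$; for a hyperplane $H_0$ of $G_0$, the semidoubling of $M_0$ (by $w$) with respect to $H_0$ is $(E_0\cup\{w+x:x\in E_0\triangle(G_0\setminus H_0)\},G)$. "Arises from $M_0$ by a sequence of doublings and/or semidoublings" means there are $M_0,\dots,M_s$ with $M_s\cong M$ and each $M_{i+1}$ isomorphic to a doubling or a semidoubling of $M_i$ (isomorphism = bijective linear map of the geometries carrying ground set onto ground set). -}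

module Defs where

open import Data.Bool using (Bool; true; false; _xor_; _∧_; not; if_then_else_)
open import Data.Nat using (ℕ; zero; suc)
open import Data.Nat.Divisibility using (_∣_)
open import Data.List using (List; []; _∷_; map; _++_; length; filter)
open import Data.Bool.ListAction using (any)
open import Data.Vec using (Vec; []; _∷_; replicate; zipWith)
open import Data.Product using (Σ; _×_)
open import Relation.Binary.PropositionalEquality using (_≡_)
open import Function.Definitions using (Bijective)

-- Vectors of F_2^n are Vec Bool n (false = 0, true = 1, xor = addition).
F2^ : ℕ → Set
F2^ n = Vec Bool n

zeros : (n : ℕ) → F2^ n
zeros n = replicate n false

_⊕_ : {n : ℕ} → F2^ n → F2^ n → F2^ n
_⊕_ = zipWith _xor_

_·_ : {n : ℕ} → Bool → F2^ n → F2^ n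
b · [] = []
b · (x ∷ xs) = (b ∧ x) ∷ (b · xs)

lin : {n k : ℕ} → Vec (F2^ n) k → F2^ k → F2^ n
lin {n} [] [] = zeros n
lin (v ∷ vs) (c ∷ cs) = (c · v) ⊕ lin vs cs

LinIndep : {n k : ℕ} → Vec (F2^ n) k → Set
LinIndep {n} {k} vs = (c : F2^ k) → lin vs c ≡ zeros n → c ≡ zeros k

allVecs : (k : ℕ) → List (F2^ k)
allVecs zero = [] ∷ []
allVecs (suc k) = map (false ∷_) (allVecs k) ++ map (true ∷_) (allVecs k)

_==_ : {n : ℕ} → F2^ n → F2^ n → Bool
[] == [] = true
(x ∷ xs) == (y ∷ ys) = (if x then y else not y) ∧ (xs == ys)

inSpan : {n k : ℕ} → Vec (F2^ n) k → F2^ n → Bool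
inSpan {k = k} vs y = any (λ c → lin vs c == y) (allVecs k)

-- A (simple binary) matroid of dimension n: E ⊆ F_2^n \ {0},
-- given as a boolean characteristic function that vanishes at 0.
record Matroid (n : ℕ) : Set where
  field
    elem  : F2^ n → Bool
    elem0 : elem (zeros n) ≡ false
open Matroid public

-- |E ∩ F| for the flat F = span(vs) \ {0}, vs linearly independent
-- (so c ↦ lin vs c is a bijection F_2^k → span(vs); 0 ∉ E).
countIn : {n k : ℕ} → Matroid n → Vec (F2^ n) k → ℕ
countIn {k = k} M vs = length (filter (λ c → elem M (lin vs c) Data.Bool.≟ true) (allVecs k))

-- The class E_3: |E ∩ F| even for every flat F of dimension ≥ 3.
-- A flat of dimension k is span(vs)\{0} for k linearly independent vectors vs.
InE3 : {n : ℕ} → Matroid n → Set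
InE3 {n} M = (k : ℕ) → 3 Data.Nat.≤ k → (vs : Vec (F2^ n) k) → LinIndep vs → 2 ∣ countIn M vs

-- Isomorphism: a bijective linear map (given by its matrix of column vectors A)
-- carrying the ground set onto the ground set.
_≅_ : {n n' : ℕ} → Matroid n → Matroid n' → Set
_≅_ {n} {n'} M M' =
  Σ (Vec (F2^ n') n) λ A → Bijective _≡_ _≡_ (lin A) × ((x : F2^ n) → elem M' (lin A x) ≡ elem M x)

-- Standard model: G = F_2^(1+n), G_0 = {0 ∷ y} (identified with F_2^n), w = 1 ∷ 0.
-- Then w + (0 ∷ y) = 1 ∷ y.
-- Doubling of M_0 by w.
double : {n : ℕ} → Matroid n → Matroid (suc n)
double M = record { elem = e ; elem0 = elem0 M }
  where
  e : _ → Bool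
  e (_ ∷ y) = elem M y

-- Semidoubling of M_0 by w with respect to the hyperplane H_0 = span(hs)\{0}
-- of G_0 = F_2^(suc m), where hs are m linearly independent vectors.
-- w + y ∈ E  iff  y ∈ E_0 △ (G_0 \ H_0)  iff  elem y xor (y ∉ span hs).
semidouble : {m : ℕ} → Matroid (suc m) → (hs : Vec (F2^ (suc m)) m) → LinIndep hs
           → Matroid (suc (suc m))
semidouble M hs _ = record { elem = e ; elem0 = elem0 M }
  where
  e : _ → Bool
  e (false ∷ y) = elem M y
  e (true ∷ y) = elem M y xor not (inSpan hs y)

data Seq : {n : ℕ} → Matroid n → Set where
  start : (M₀ : Matroid 2) → Seq M₀
  dbl   : {n : ℕ} {M : Matroid n} {M' : Matroid (suc n)}
        → Seq M → M' ≅ double M → Seq M'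
  sdbl  : {m : ℕ} {M : Matroid (suc m)} {M' : Matroid (suc (suc m))}
        → Seq M → (hs : Vec (F2^ (suc m)) m) (ind : LinIndep hs)
        → M' ≅ semidouble M hs ind → Seq M'

ArisesFrom2 : {n : ℕ} → Matroid n → Set
ArisesFrom2 M = Σ ℕ λ n' → Σ (Matroid n') λ Ms → Seq Ms × (Ms ≅ M)

-- Identify E with its characteristic function f : F₂ⁿ → F₂.  The sum of f over the linear
-- flat spanned by v₁ … v_k is the iterated finite difference Δ_{v₁} ⋯ Δ_{v_k} f at 0, and it
-- vanishes when the vᵢ are dependent, because the summand is then periodic.  Since
-- Δ_{v₁} ⋯ Δ_{v₃} f (x) is the difference of the sums over the flats spanned by v₁, v₂, v₃, x
-- and by v₁, v₂, v₃, the condition M ∈ E₃ says exactly that all third differences of f vanish,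
-- i.e. f is a polynomial of degree at most 2.
--
-- This degree bound holds for every function on F₂², and it survives doubling
-- (f (b , y) = f₀ y) and semidoubling (f (b , y) = f₀ y + b χ y, where the indicator χ of the
-- complement of a hyperplane is linear).  Conversely, let deg f ≤ 2 and n ≥ 3.  Then f sums
-- to 0 over F₂ⁿ, whereas the indicator of F₂ⁿ ∖ {0} sums to 2ⁿ − 1, so some w ≠ 0 lies
-- outside E.  In coordinates with w = e₁ we get f (b , y) = f₀ y + b ℓ y, where
-- ℓ y = f (1 , y) + f (0 , y) has degree at most 1 and ℓ 0 = f e₁ + f 0 = 0, so ℓ is linear.
-- If ℓ = 0, M is the doubling of f₀; otherwise, after a change of coordinates making ℓ the
-- first coordinate, M is a semidoubling with respect to ker ℓ.  Induction on n finishes the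
-- proof.

module Submission where

open import Defs
open import Data.Bool using (Bool; true; false; _xor_; _∧_; not; T; _≟_)
open import Data.Bool.Properties
  using ( xor-assoc; xor-comm; xor-same; xor-identityˡ; xor-identityʳ; ∧-zeroʳ; ∧-identityʳ
        ; ∧-distribʳ-xor; not-involutive; not-distribˡ-xor; ¬-not )
open import Data.Bool.Solver using (module xor-∧-Solver)
open import Data.Empty using (⊥-elim)
open import Data.Fin as Fin using (Fin; combine; remQuot)
open import Data.Fin.Properties using (2↔Bool; remQuot-combine; combine-remQuot; any?; pigeonhole; <⇒≢)
open import Data.List as List using (List; []; _∷_; _++_; length; filter)
open import Data.List.Membership.Propositional using (_∈_; find; lose)
open import Data.List.Membership.Propositional.Properties using (∈-map⁺; ∈-++⁺ˡ; ∈-++⁺ʳ)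
open import Data.List.Properties using (filter-++; length-++)
open import Data.List.Relation.Unary.Any using (here)
open import Data.List.Relation.Unary.Any.Properties using (any⁺; any⁻)
open import Data.Nat using (ℕ; zero; suc; _+_; _≤_; _<_; _^_; z≤n; s≤s)
open import Data.Nat.Divisibility using (_∣_; divides; ∣-refl; ∣m∣n⇒∣m+n; ∣m+n∣m⇒∣n)
open import Data.Nat.Properties using (^-monoʳ-<; n<1+n; ≤-refl)
open import Data.Product using (Σ; ∃; _×_; _,_; proj₁; proj₂)
open import Data.Unit using (tt)
open import Data.Vec using (Vec; []; _∷_; _∷ʳ_; head; tail; map)
open import Data.Vec.Properties
  using (zipWith-assoc; zipWith-comm; zipWith-identityˡ; zipWith-identityʳ; ≡-dec)
open import Function using (_∘_; case_of_)
open import Function.Bundles using (Inverse)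
open import Relation.Binary.PropositionalEquality
open import Relation.Nullary using (¬_)
open import Relation.Nullary.Decidable
  using (Dec; yes; no; does; map′; ¬?; _×-dec_; decidable-stable)
open import Relation.Nullary.Reflects using (Reflects; ofʸ; ofⁿ; fromEquivalence; det)
open ≡-Reasoning

private
  variable
    m n k d : ℕ

-- Linear algebra over F₂

xor-interchange : ∀ a b c d → (a xor b) xor (c xor d) ≡ (a xor c) xor (b xor d)
xor-interchange = solve 4 (λ a b c d → (a :+ b) :+ (c :+ d) := (a :+ c) :+ (b :+ d)) refl
  where open xor-∧-Solver

xor-cancelʳ : ∀ p q → (p xor q) xor q ≡ p
xor-cancelʳ p q = trans (xor-assoc p q q) (trans (cong (p xor_) (xor-same q)) (xor-identityʳ p))

xor≡false⇒≡ : ∀ {p q} → p xor q ≡ false → p ≡ q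
xor≡false⇒≡ {p} {q} eq = trans (sym (xor-cancelʳ p q)) (cong (_xor q) eq)

⊕-assoc : (x y z : F2^ n) → (x ⊕ y) ⊕ z ≡ x ⊕ (y ⊕ z)
⊕-assoc = zipWith-assoc xor-assoc

⊕-comm : (x y : F2^ n) → x ⊕ y ≡ y ⊕ x
⊕-comm = zipWith-comm xor-comm

⊕-identityˡ : (x : F2^ n) → zeros n ⊕ x ≡ x
⊕-identityˡ = zipWith-identityˡ xor-identityˡ

⊕-identityʳ : (x : F2^ n) → x ⊕ zeros n ≡ x
⊕-identityʳ = zipWith-identityʳ xor-identityʳ

⊕-self : (x : F2^ n) → x ⊕ x ≡ zeros n
⊕-self []      = refl
⊕-self (b ∷ x) = cong₂ _∷_ (xor-same b) (⊕-self x)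

⊕-cancelʳ : (x y : F2^ n) → (x ⊕ y) ⊕ y ≡ x
⊕-cancelʳ x y = begin
  (x ⊕ y) ⊕ y  ≡⟨ ⊕-assoc x y y ⟩
  x ⊕ (y ⊕ y)  ≡⟨ cong (x ⊕_) (⊕-self y) ⟩
  x ⊕ zeros _  ≡⟨ ⊕-identityʳ x ⟩
  x            ∎

⊕-cancelˡ : (x y : F2^ n) → x ⊕ (x ⊕ y) ≡ y
⊕-cancelˡ x y = trans (⊕-comm x (x ⊕ y)) (trans (cong (_⊕ x) (⊕-comm x y)) (⊕-cancelʳ y x))

⊕≡zeros⇒≡ : (x y : F2^ n) → x ⊕ y ≡ zeros n → x ≡ y
⊕≡zeros⇒≡ x y eq = begin
  x            ≡⟨ sym (⊕-cancelʳ x y) ⟩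
  (x ⊕ y) ⊕ y  ≡⟨ cong (_⊕ y) eq ⟩
  zeros _ ⊕ y  ≡⟨ ⊕-identityˡ y ⟩
  y            ∎

⊕-interchange : (w x y z : F2^ n) → (w ⊕ x) ⊕ (y ⊕ z) ≡ (w ⊕ y) ⊕ (x ⊕ z)
⊕-interchange [] [] [] [] = refl
⊕-interchange (a ∷ w) (b ∷ x) (c ∷ y) (d ∷ z) =
  cong₂ _∷_ (xor-interchange a b c d) (⊕-interchange w x y z)

·-identityˡ : (x : F2^ n) → true · x ≡ x
·-identityˡ []      = refl
·-identityˡ (a ∷ x) = cong (a ∷_) (·-identityˡ x)

·-zeroˡ : (x : F2^ n) → false · x ≡ zeros n
·-zeroˡ []      = refl
·-zeroˡ (a ∷ x) = cong (false ∷_) (·-zeroˡ x)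

·-zeroʳ : (b : Bool) → b · zeros n ≡ zeros n
·-zeroʳ {zero}  b = refl
·-zeroʳ {suc n} b = cong₂ _∷_ (∧-zeroʳ b) (·-zeroʳ b)

·-distribʳ-xor : (a b : Bool) (x : F2^ n) → (a xor b) · x ≡ (a · x) ⊕ (b · x)
·-distribʳ-xor a b []      = refl
·-distribʳ-xor a b (c ∷ x) = cong₂ _∷_ (∧-distribʳ-xor c a b) (·-distribʳ-xor a b x)

record Linear (f : F2^ m → F2^ n) : Set where
  constructor linear
  field ⊕-homo : ∀ x y → f (x ⊕ y) ≡ f x ⊕ f y
open Linear

record LinearForm (ℓ : F2^ n → Bool) : Set where
  constructor linearForm
  field xor-homo : ∀ x y → ℓ (x ⊕ y) ≡ ℓ x xor ℓ y
open LinearForm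

Linear-zeros : {f : F2^ m → F2^ n} → Linear f → f (zeros m) ≡ zeros n
Linear-zeros {m} {f = f} lin-f = begin
  f (zeros m)                ≡⟨ cong f (sym (⊕-self (zeros m))) ⟩
  f (zeros m ⊕ zeros m)      ≡⟨ ⊕-homo lin-f (zeros m) (zeros m) ⟩
  f (zeros m) ⊕ f (zeros m)  ≡⟨ ⊕-self (f (zeros m)) ⟩
  zeros _                    ∎

LinearForm-zeros : {ℓ : F2^ n → Bool} → LinearForm ℓ → ℓ (zeros n) ≡ false
LinearForm-zeros {n} {ℓ} lin-ℓ = begin
  ℓ (zeros n)                  ≡⟨ cong ℓ (sym (⊕-self (zeros n))) ⟩
  ℓ (zeros n ⊕ zeros n)        ≡⟨ xor-homo lin-ℓ (zeros n) (zeros n) ⟩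
  ℓ (zeros n) xor ℓ (zeros n)  ≡⟨ xor-same (ℓ (zeros n)) ⟩
  false                        ∎

LinearForm-∘ : {ℓ : F2^ n → Bool} {f : F2^ m → F2^ n} →
               LinearForm ℓ → Linear f → LinearForm (ℓ ∘ f)
LinearForm-∘ {ℓ = ℓ} lin-ℓ lin-f =
  linearForm λ x y → trans (cong ℓ (⊕-homo lin-f x y)) (xor-homo lin-ℓ _ _)

Linear-· : {f : F2^ m → F2^ n} → Linear f → (b : Bool) (x : F2^ m) → f (b · x) ≡ b · f x
Linear-· {f = f} lin-f true  x = trans (cong f (·-identityˡ x)) (sym (·-identityˡ (f x)))
Linear-· {f = f} lin-f false x =
  trans (cong f (·-zeroˡ x)) (trans (Linear-zeros lin-f) (sym (·-zeroˡ (f x))))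

lin-linear : (vs : Vec (F2^ n) k) → Linear (lin vs)
lin-linear []       = linear λ { [] [] → sym (⊕-self _) }
lin-linear (v ∷ vs) = linear λ { (a ∷ c) (b ∷ d) →
  trans (cong₂ _⊕_ (·-distribʳ-xor a b v) (⊕-homo (lin-linear vs) c d)) (⊕-interchange _ _ _ _) }

lin-map : {f : F2^ m → F2^ n} → Linear f → (vs : Vec (F2^ m) k) (c : F2^ k) →
          lin (map f vs) c ≡ f (lin vs c)
lin-map lin-f []       []      = sym (Linear-zeros lin-f)
lin-map lin-f (v ∷ vs) (b ∷ c) =
  trans (cong₂ _⊕_ (sym (Linear-· lin-f b v)) (lin-map lin-f vs c)) (sym (⊕-homo lin-f _ _))

e₁ : F2^ (suc n)
e₁ {n} = true ∷ zeros n

basis : (n : ℕ) → Vec (F2^ n) n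
basis zero    = []
basis (suc n) = e₁ ∷ map (false ∷_) (basis n)

lin-basis : (c : F2^ n) → lin (basis n) c ≡ c
lin-basis []      = refl
lin-basis {suc n} (b ∷ c) = begin
  (b · e₁) ⊕ lin (map (false ∷_) (basis n)) c
    ≡⟨ cong ((b · e₁) ⊕_) (lin-map (linear λ _ _ → refl) (basis n) c) ⟩
  (b · e₁) ⊕ (false ∷ lin (basis n) c)
    ≡⟨ cong (λ t → (b · e₁) ⊕ (false ∷ t)) (lin-basis c) ⟩
  ((b ∧ true) xor false) ∷ (b · zeros n) ⊕ c
    ≡⟨ cong₂ _∷_ (trans (xor-identityʳ _) (∧-identityʳ b))
                 (trans (cong (_⊕ c) (·-zeroʳ b)) (⊕-identityˡ c)) ⟩
  b ∷ c
    ∎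

record Aut (n : ℕ) : Set where
  field
    to        : F2^ n → F2^ n
    from      : F2^ n → F2^ n
    to-linear : Linear to
    to-from   : ∀ x → to (from x) ≡ x
    from-to   : ∀ x → from (to x) ≡ x

  from-linear : Linear from
  from-linear = linear λ x y → begin
    from (x ⊕ y)                      ≡⟨ cong₂ (λ s t → from (s ⊕ t)) (sym (to-from x)) (sym (to-from y)) ⟩
    from (to (from x) ⊕ to (from y))  ≡⟨ cong from (sym (⊕-homo to-linear (from x) (from y))) ⟩
    from (to (from x ⊕ from y))       ≡⟨ from-to _ ⟩
    from x ⊕ from y                   ∎

open Aut

involution : (f : F2^ n → F2^ n) → Linear f → (∀ x → f (f x) ≡ x) → Aut n
involution f lin-f inv = record
  { to = f ; from = f ; to-linear = lin-f ; to-from = inv ; from-to = inv }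

Aut-id : Aut n
Aut-id = involution (λ x → x) (linear λ _ _ → refl) (λ _ → refl)

_⁻¹ : Aut n → Aut n
P ⁻¹ = record
  { to = from P ; from = to P ; to-linear = from-linear P ; to-from = from-to P ; from-to = to-from P }

_∘ᴬ_ : Aut n → Aut n → Aut n
Q ∘ᴬ P = record
  { to        = to Q ∘ to P
  ; from      = from P ∘ from Q
  ; to-linear = linear λ x y →
      trans (cong (to Q) (⊕-homo (to-linear P) x y)) (⊕-homo (to-linear Q) _ _)
  ; to-from   = λ x → trans (cong (to Q) (to-from P _)) (to-from Q x)
  ; from-to   = λ x → trans (cong (from P) (from-to Q _)) (from-to P x)
  }

Aut-lift : Aut n → Aut (suc n)
Aut-lift P = record
  { to        = λ { (b ∷ x) → b ∷ to P x }
  ; from      = λ { (b ∷ x) → b ∷ from P x }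
  ; to-linear = linear λ { (a ∷ x) (b ∷ y) → cong ((a xor b) ∷_) (⊕-homo (to-linear P) x y) }
  ; to-from   = λ { (b ∷ x) → cong (b ∷_) (to-from P x) }
  ; from-to   = λ { (b ∷ x) → cong (b ∷_) (from-to P x) }
  }

Aut-swap : Aut (suc (suc n))
Aut-swap = involution swap (linear λ { (a ∷ b ∷ x) (c ∷ d ∷ y) → refl }) (λ { (a ∷ b ∷ x) → refl })
  where
  swap : F2^ (suc (suc n)) → F2^ (suc (suc n))
  swap (a ∷ b ∷ x) = b ∷ a ∷ x

Aut-shear : F2^ n → Aut (suc n)
Aut-shear w = involution shear shear-linear (λ { (c ∷ x) → cong (c ∷_) (⊕-cancelʳ x (c · w)) })
  where
  shear : F2^ (suc _) → F2^ (suc _)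
  shear (c ∷ x) = c ∷ x ⊕ (c · w)
  shear-linear : Linear shear
  shear-linear = linear λ { (c ∷ x) (d ∷ y) → cong ((c xor d) ∷_)
    (trans (cong ((x ⊕ y) ⊕_) (·-distribʳ-xor c d w)) (⊕-interchange x y (c · w) (d · w))) }

Aut-to-e₁ : (w : F2^ (suc n)) → w ≢ zeros (suc n) → Σ (Aut (suc n)) λ P → to P w ≡ e₁
Aut-to-e₁ (true ∷ w) _ =
  Aut-shear w , cong (true ∷_) (trans (cong (w ⊕_) (·-identityˡ w)) (⊕-self w))
Aut-to-e₁ {zero}  (false ∷ []) w≢0 = ⊥-elim (w≢0 refl)
Aut-to-e₁ {suc n} (false ∷ w)  w≢0 =
  let (P , Pw≡e₁) = Aut-to-e₁ w (w≢0 ∘ cong (false ∷_))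
  in Aut-swap ∘ᴬ Aut-lift P , cong (to Aut-swap ∘ (false ∷_)) Pw≡e₁

Aut⇒≅ : {M : Matroid n} {M′ : Matroid n} (P : Aut n) →
        (∀ y → elem M′ y ≡ elem M (from P y)) → M ≅ M′
Aut⇒≅ {n} {M} {M′} P M′≡M∘P⁻¹ = A , (injective , surjective) , preserves
  where
  A : Vec (F2^ n) n
  A = map (to P) (basis n)
  lin-A : ∀ x → lin A x ≡ to P x
  lin-A x = trans (lin-map (to-linear P) (basis n) x) (cong (to P) (lin-basis x))
  injective : ∀ {x y} → lin A x ≡ lin A y → x ≡ y
  injective {x} {y} eq = begin
    x                ≡⟨ sym (from-to P x) ⟩
    from P (to P x)  ≡⟨ cong (from P) (trans (sym (lin-A x)) (trans eq (lin-A y))) ⟩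
    from P (to P y)  ≡⟨ from-to P y ⟩
    y                ∎
  surjective : ∀ y → ∃ λ x → ∀ {z} → z ≡ x → lin A z ≡ y
  surjective y = from P y , λ { refl → trans (lin-A _) (to-from P y) }
  preserves : ∀ x → elem M′ (lin A x) ≡ elem M x
  preserves x = trans (cong (elem M′) (lin-A x))
                      (trans (M′≡M∘P⁻¹ (to P x)) (cong (elem M) (from-to P x)))

-- Finite differences and degree

Δ : F2^ n → (F2^ n → Bool) → F2^ n → Bool
Δ a g x = g (x ⊕ a) xor g x

private
  variable
    g h : F2^ n → Bool

-- g is a polynomial function of degree below d over F₂.
data Degree< {n : ℕ} : ℕ → (F2^ n → Bool) → Set where
  vanishing : (∀ x → g x ≡ false) → Degree< zero g
  by-Δ      : (∀ a → Degree< d (Δ a g)) → Degree< (suc d) g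

Δ-LinearForm : {ℓ : F2^ n → Bool} → LinearForm ℓ → ∀ a x → Δ a ℓ x ≡ ℓ a
Δ-LinearForm {ℓ = ℓ} lin-ℓ a x =
  trans (cong (_xor ℓ x) (trans (xor-homo lin-ℓ x a) (xor-comm (ℓ x) (ℓ a))))
        (xor-cancelʳ (ℓ a) (ℓ x))

Δ-∘ : {f : F2^ m → F2^ n} → Linear f → ∀ a x → Δ a (g ∘ f) x ≡ Δ (f a) g (f x)
Δ-∘ {g = g} {f = f} lin-f a x = cong (λ t → g t xor g (f x)) (⊕-homo lin-f x a)

split-head : (g : F2^ (suc n) → Bool) (b : Bool) (y : F2^ n) →
             g (b ∷ y) ≡ g (false ∷ y) xor (b ∧ Δ e₁ g (false ∷ y))
split-head g false y = sym (xor-identityʳ _)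
split-head g true  y = sym (begin
  g (false ∷ y) xor (g (true ∷ y ⊕ zeros _) xor g (false ∷ y))
    ≡⟨ cong (λ t → g (false ∷ y) xor (g (true ∷ t) xor g (false ∷ y))) (⊕-identityʳ y) ⟩
  g (false ∷ y) xor (g (true ∷ y) xor g (false ∷ y))
    ≡⟨ xor-comm (g (false ∷ y)) _ ⟩
  (g (true ∷ y) xor g (false ∷ y)) xor g (false ∷ y)
    ≡⟨ xor-cancelʳ _ _ ⟩
  g (true ∷ y) ∎)

Degree<-resp : (∀ x → g x ≡ h x) → Degree< d g → Degree< d h
Degree<-resp g≗h (vanishing g≡0) = vanishing λ x → trans (sym (g≗h x)) (g≡0 x)
Degree<-resp g≗h (by-Δ deg)      =
  by-Δ λ a → Degree<-resp (λ x → cong₂ _xor_ (g≗h (x ⊕ a)) (g≗h x)) (deg a)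

Degree<-xor : Degree< d g → Degree< d h → Degree< d (λ x → g x xor h x)
Degree<-xor (vanishing g≡0) (vanishing h≡0) = vanishing λ x → cong₂ _xor_ (g≡0 x) (h≡0 x)
Degree<-xor {g = g} {h = h} (by-Δ deg-g) (by-Δ deg-h) = by-Δ λ a →
  Degree<-resp (λ x → xor-interchange (g (x ⊕ a)) (g x) (h (x ⊕ a)) (h x))
               (Degree<-xor (deg-g a) (deg-h a))

Degree<-false : Degree< {n} d (λ _ → false)
Degree<-false {d = zero}  = vanishing λ _ → refl
Degree<-false {d = suc d} = by-Δ λ _ → Degree<-false

Degree<-scale : (b : Bool) → Degree< d g → Degree< d (λ x → b ∧ g x)
Degree<-scale false _   = Degree<-false
Degree<-scale true  deg = deg

Degree<-suc : Degree< d g → Degree< (suc d) g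
Degree<-suc (vanishing g≡0) = by-Δ λ a → vanishing λ x → cong₂ _xor_ (g≡0 (x ⊕ a)) (g≡0 x)
Degree<-suc (by-Δ deg)      = by-Δ λ a → Degree<-suc (deg a)

Degree<-Δ : Degree< (suc d) g → ∀ a → Degree< d (Δ a g)
Degree<-Δ (by-Δ deg) = deg

Degree<-mono : d ≤ k → Degree< d g → Degree< k g
Degree<-mono {k = zero}  z≤n       deg        = deg
Degree<-mono {k = suc k} z≤n       deg        = Degree<-suc (Degree<-mono z≤n deg)
Degree<-mono             (s≤s d≤k) (by-Δ deg) = by-Δ λ a → Degree<-mono d≤k (deg a)

Degree<-shift : (a : F2^ n) → Degree< d g → Degree< d (λ x → g (x ⊕ a))
Degree<-shift {g = g} a deg =
  Degree<-resp (λ x → xor-cancelʳ (g (x ⊕ a)) (g x))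
               (Degree<-xor (Degree<-Δ (Degree<-suc deg) a) deg)

Degree<-∘ : {f : F2^ m → F2^ n} → Linear f → Degree< d g → Degree< d (g ∘ f)
Degree<-∘ {f = f} lin-f (vanishing g≡0) = vanishing (g≡0 ∘ f)
Degree<-∘ {g = g} {f = f} lin-f (by-Δ deg) = by-Δ λ a →
  Degree<-resp (λ x → sym (Δ-∘ {g = g} lin-f a x)) (Degree<-∘ lin-f (deg (f a)))

Degree<-∘⁻ : {f : F2^ m → F2^ n} → Linear f → (∀ y → ∃ λ x → f x ≡ y) →
             Degree< d (g ∘ f) → Degree< d g
Degree<-∘⁻ {g = g} lin-f surj (vanishing g∘f≡0) = vanishing λ y → let (x , fx≡y) = surj y in
  subst (λ t → g t ≡ false) fx≡y (g∘f≡0 x)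
Degree<-∘⁻ {g = g} lin-f surj (by-Δ deg)       = by-Δ λ a → let (a′ , fa′≡a) = surj a in
  subst (λ t → Degree< _ (Δ t g)) fa′≡a
        (Degree<-∘⁻ lin-f surj (Degree<-resp (Δ-∘ {g = g} lin-f a′) (deg a′)))

LinearForm⇒Degree<2 : {ℓ : F2^ n → Bool} → LinearForm ℓ → Degree< 2 ℓ
LinearForm⇒Degree<2 {ℓ = ℓ} lin-ℓ = by-Δ λ a → by-Δ λ b → vanishing λ x →
  trans (cong₂ _xor_ (Δ-LinearForm lin-ℓ a (x ⊕ b)) (Δ-LinearForm lin-ℓ a x)) (xor-same (ℓ a))

Degree<2⇒LinearForm : {ℓ : F2^ n → Bool} → Degree< 2 ℓ → ℓ (zeros n) ≡ false → LinearForm ℓ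
Degree<2⇒LinearForm {n} {ℓ} (by-Δ deg) ℓ0≡false = linearForm homo
  where
  homo : ∀ x y → ℓ (x ⊕ y) ≡ ℓ x xor ℓ y
  homo x y = begin
    ℓ (x ⊕ y)                ≡⟨ sym (xor-cancelʳ _ (ℓ x)) ⟩
    Δ y ℓ x xor ℓ x          ≡⟨ cong (_xor ℓ x) Δyℓ-constant ⟩
    Δ y ℓ (zeros n) xor ℓ x  ≡⟨ cong₂ (λ s t → (ℓ s xor t) xor ℓ x) (⊕-identityˡ y) ℓ0≡false ⟩
    (ℓ y xor false) xor ℓ x  ≡⟨ cong (_xor ℓ x) (xor-identityʳ (ℓ y)) ⟩
    ℓ y xor ℓ x              ≡⟨ xor-comm (ℓ y) (ℓ x) ⟩
    ℓ x xor ℓ y              ∎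
    where
    Δ²ℓ≡0 : ∀ z → Δ x (Δ y ℓ) z ≡ false
    Δ²ℓ≡0 with deg y
    ... | by-Δ deg′ with deg′ x
    ...   | vanishing Δ²≡0 = Δ²≡0
    Δyℓ-constant : Δ y ℓ x ≡ Δ y ℓ (zeros n)
    Δyℓ-constant = trans (cong (Δ y ℓ) (sym (⊕-identityˡ x))) (xor≡false⇒≡ (Δ²ℓ≡0 (zeros n)))

Δ-∧ : {ℓ : F2^ n → Bool} → LinearForm ℓ → ∀ a x →
      Δ a (λ z → ℓ z ∧ h z) x ≡ (ℓ x ∧ Δ a h x) xor (ℓ a ∧ h (x ⊕ a))
Δ-∧ {h = h} {ℓ = ℓ} lin-ℓ a x =
  trans (cong (λ t → (t ∧ h (x ⊕ a)) xor (ℓ x ∧ h x)) (xor-homo lin-ℓ x a))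
        (product-rule (ℓ x) (ℓ a) (h (x ⊕ a)) (h x))
  where
  open xor-∧-Solver
  product-rule : ∀ p q r s → ((p xor q) ∧ r) xor (p ∧ s) ≡ (p ∧ (r xor s)) xor (q ∧ r)
  product-rule = solve 4 (λ p q r s → ((p :+ q) :* r) :+ (p :* s) := (p :* (r :+ s)) :+ (q :* r)) refl

LinearForm-∧-Degree< : {ℓ : F2^ n → Bool} → LinearForm ℓ → Degree< d h →
                       Degree< (suc d) (λ x → ℓ x ∧ h x)
LinearForm-∧-Degree< {ℓ = ℓ} lin-ℓ (vanishing h≡0) =
  Degree<-suc (vanishing λ x → trans (cong (ℓ x ∧_) (h≡0 x)) (∧-zeroʳ (ℓ x)))
LinearForm-∧-Degree< {h = h} {ℓ = ℓ} lin-ℓ deg@(by-Δ Δdeg) = by-Δ λ a →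
  Degree<-resp (λ x → sym (Δ-∧ {h = h} lin-ℓ a x))
    (Degree<-xor (LinearForm-∧-Degree< lin-ℓ (Δdeg a))
                 (Degree<-scale (ℓ a) (Degree<-shift a deg)))

Aut-straighten : {ℓ : F2^ (suc n) → Bool} → LinearForm ℓ → (y : F2^ (suc n)) → ℓ y ≡ true →
                 Σ (Aut (suc n)) λ ψ → ∀ u → ℓ (to ψ u) ≡ head u
Aut-straighten {n} {ℓ} lin-ℓ y ℓy≡true = (P ⁻¹) ∘ᴬ involution F F-linear F-involutive , ℓ∘ψ
  where
  y≢0 : y ≢ zeros (suc n)
  y≢0 refl with trans (sym ℓy≡true) (LinearForm-zeros lin-ℓ)
  ... | ()
  P : Aut (suc n)
  P = proj₁ (Aut-to-e₁ y y≢0)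
  ℓ′ : F2^ (suc n) → Bool
  ℓ′ = ℓ ∘ from P
  lin-ℓ′ : LinearForm ℓ′
  lin-ℓ′ = LinearForm-∘ lin-ℓ (from-linear P)
  ℓ′e₁ : ℓ′ e₁ ≡ true
  ℓ′e₁ = trans (cong ℓ′ (sym (proj₂ (Aut-to-e₁ y y≢0))))
               (trans (cong ℓ (from-to P y)) ℓy≡true)
  ℓ′-∷ : ∀ b x → ℓ′ (b ∷ x) ≡ ℓ′ (false ∷ x) xor b
  ℓ′-∷ b x = begin
    ℓ′ (b ∷ x)
      ≡⟨ split-head ℓ′ b x ⟩
    ℓ′ (false ∷ x) xor (b ∧ Δ e₁ ℓ′ (false ∷ x))
      ≡⟨ cong (λ t → ℓ′ (false ∷ x) xor (b ∧ t)) (trans (Δ-LinearForm lin-ℓ′ e₁ _) ℓ′e₁) ⟩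
    ℓ′ (false ∷ x) xor (b ∧ true)
      ≡⟨ cong (ℓ′ (false ∷ x) xor_) (∧-identityʳ b) ⟩
    ℓ′ (false ∷ x) xor b
      ∎
  F : F2^ (suc n) → F2^ (suc n)
  F (c ∷ x) = (c xor ℓ′ (false ∷ x)) ∷ x
  F-linear : Linear F
  F-linear = linear λ { (c ∷ x) (d ∷ z) → cong (_∷ (x ⊕ z))
    (trans (cong ((c xor d) xor_) (xor-homo lin-ℓ′ (false ∷ x) (false ∷ z)))
           (xor-interchange c d _ _)) }
  F-involutive : ∀ x → F (F x) ≡ x
  F-involutive (c ∷ x) = cong (_∷ x) (xor-cancelʳ c _)
  ℓ∘ψ : ∀ u → ℓ′ (F u) ≡ head u
  ℓ∘ψ (c ∷ x) = trans (ℓ′-∷ _ x) (trans (xor-comm t (c xor t)) (xor-cancelʳ c t))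
    where t = ℓ′ (false ∷ x)

-- Sums over flats

Δs : Vec (F2^ n) k → (F2^ n → Bool) → F2^ n → Bool
Δs []       g = g
Δs (v ∷ vs) g = Δs vs (Δ v g)

Degree<⇒Δs≡false : Degree< k g → (vs : Vec (F2^ n) k) (x : F2^ n) → Δs vs g x ≡ false
Degree<⇒Δs≡false (vanishing g≡0) []       = g≡0
Degree<⇒Δs≡false (by-Δ deg)      (v ∷ vs) = Degree<⇒Δs≡false (deg v) vs

Δs≡false⇒Degree< : (∀ (vs : Vec (F2^ n) k) x → Δs vs g x ≡ false) → Degree< k g
Δs≡false⇒Degree< {k = zero}  Δs≡0 = vanishing (Δs≡0 [])
Δs≡false⇒Degree< {k = suc k} Δs≡0 = by-Δ λ a → Δs≡false⇒Degree< (λ vs → Δs≡0 (a ∷ vs))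

Δs-∷ʳ : (vs : Vec (F2^ n) k) (v x : F2^ n) → Δs (vs ∷ʳ v) g x ≡ Δ v (Δs vs g) x
Δs-∷ʳ         []       v x = refl
Δs-∷ʳ {g = g} (w ∷ vs) v x = Δs-∷ʳ {g = Δ w g} vs v x

xorSum : (k : ℕ) → (F2^ k → Bool) → Bool
xorSum zero    g = g []
xorSum (suc k) g = xorSum k (g ∘ (false ∷_)) xor xorSum k (g ∘ (true ∷_))

xorSum-resp : (∀ c → g c ≡ h c) → xorSum k g ≡ xorSum k h
xorSum-resp {k = zero}  g≗h = g≗h []
xorSum-resp {k = suc k} g≗h =
  cong₂ _xor_ (xorSum-resp (g≗h ∘ (false ∷_))) (xorSum-resp (g≗h ∘ (true ∷_)))

xorSum-xor : (g h : F2^ k → Bool) → xorSum k (λ c → g c xor h c) ≡ xorSum k g xor xorSum k h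
xorSum-xor {zero}  g h = refl
xorSum-xor {suc k} g h =
  trans (cong₂ _xor_ (xorSum-xor (g ∘ (false ∷_)) (h ∘ (false ∷_)))
                     (xorSum-xor (g ∘ (true ∷_)) (h ∘ (true ∷_))))
        (xor-interchange (xorSum k (g ∘ (false ∷_))) (xorSum k (h ∘ (false ∷_)))
                         (xorSum k (g ∘ (true ∷_)))  (xorSum k (h ∘ (true ∷_))))

xorSum-translate : (g : F2^ k → Bool) (a : F2^ k) → xorSum k (λ c → g (c ⊕ a)) ≡ xorSum k g
xorSum-translate {zero}  g []       = refl
xorSum-translate {suc k} g (false ∷ a) =
  cong₂ _xor_ (xorSum-translate (g ∘ (false ∷_)) a) (xorSum-translate (g ∘ (true ∷_)) a)
xorSum-translate {suc k} g (true ∷ a) =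
  trans (cong₂ _xor_ (xorSum-translate (g ∘ (true ∷_)) a) (xorSum-translate (g ∘ (false ∷_)) a))
        (xor-comm (xorSum k (g ∘ (true ∷_))) (xorSum k (g ∘ (false ∷_))))

xorSum-periodic : (g : F2^ k → Bool) {a : F2^ k} → a ≢ zeros k → (∀ c → g (c ⊕ a) ≡ g c) →
                  xorSum k g ≡ false
xorSum-periodic {zero}  g {[]}    a≢0 _ = ⊥-elim (a≢0 refl)
xorSum-periodic {suc k} g {true ∷ a} _ periodic = begin
  xorSum k g₀ xor xorSum k (g ∘ (true ∷_))
    ≡⟨ cong (xorSum k g₀ xor_) (xorSum-resp (sym ∘ periodic ∘ (true ∷_))) ⟩
  xorSum k g₀ xor xorSum k (λ c → g₀ (c ⊕ a))
    ≡⟨ cong (xorSum k g₀ xor_) (xorSum-translate g₀ a) ⟩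
  xorSum k g₀ xor xorSum k g₀
    ≡⟨ xor-same (xorSum k g₀) ⟩
  false
    ∎
  where
  g₀ : F2^ k → Bool
  g₀ = g ∘ (false ∷_)
xorSum-periodic {suc k} g {false ∷ a} a≢0 periodic =
  cong₂ _xor_ (xorSum-periodic (g ∘ (false ∷_)) (a≢0 ∘ cong (false ∷_)) (periodic ∘ (false ∷_)))
              (xorSum-periodic (g ∘ (true ∷_))  (a≢0 ∘ cong (false ∷_)) (periodic ∘ (true ∷_)))

xorSum-flat : (vs : Vec (F2^ n) k) (g : F2^ n → Bool) (x : F2^ n) →
              xorSum k (λ c → g (lin vs c ⊕ x)) ≡ Δs vs g x
xorSum-flat                []       g x = cong g (⊕-identityˡ x)
xorSum-flat {k = suc k} (v ∷ vs) g x = begin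
  xorSum k (λ c → g (((false · v) ⊕ lin vs c) ⊕ x)) xor
  xorSum k (λ c → g (((true · v) ⊕ lin vs c) ⊕ x))
    ≡⟨ cong₂ _xor_ (xorSum-resp (cong g ∘ off-v)) (xorSum-resp (cong g ∘ on-v)) ⟩
  xorSum k (λ c → g (y c)) xor xorSum k (λ c → g (y c ⊕ v))
    ≡⟨ xor-comm (xorSum k (g ∘ y)) (xorSum k (λ c → g (y c ⊕ v))) ⟩
  xorSum k (λ c → g (y c ⊕ v)) xor xorSum k (λ c → g (y c))
    ≡⟨ sym (xorSum-xor (λ c → g (y c ⊕ v)) (g ∘ y)) ⟩
  xorSum k (λ c → Δ v g (lin vs c ⊕ x))
    ≡⟨ xorSum-flat vs (Δ v g) x ⟩
  Δs vs (Δ v g) x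
    ∎
  where
  y : F2^ k → F2^ _
  y c = lin vs c ⊕ x
  off-v : ∀ c → ((false · v) ⊕ lin vs c) ⊕ x ≡ y c
  off-v c = cong (_⊕ x) (trans (cong (_⊕ lin vs c) (·-zeroˡ v)) (⊕-identityˡ (lin vs c)))
  on-v : ∀ c → ((true · v) ⊕ lin vs c) ⊕ x ≡ y c ⊕ v
  on-v c = begin
    ((true · v) ⊕ lin vs c) ⊕ x  ≡⟨ cong (λ t → (t ⊕ lin vs c) ⊕ x) (·-identityˡ v) ⟩
    (v ⊕ lin vs c) ⊕ x           ≡⟨ ⊕-assoc v (lin vs c) x ⟩
    v ⊕ y c                      ≡⟨ ⊕-comm v (y c) ⟩
    y c ⊕ v                      ∎

xorSum-∘lin : (vs : Vec (F2^ n) k) (g : F2^ n → Bool) → xorSum k (g ∘ lin vs) ≡ Δs vs g (zeros n)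
xorSum-∘lin vs g =
  trans (xorSum-resp (λ c → cong g (sym (⊕-identityʳ (lin vs c))))) (xorSum-flat vs g (zeros _))

xorSum-dependent : (vs : Vec (F2^ n) k) (g : F2^ n → Bool) (x : F2^ n) {a : F2^ k} →
                   a ≢ zeros k → lin vs a ≡ zeros n → xorSum k (λ c → g (lin vs c ⊕ x)) ≡ false
xorSum-dependent vs g x {a} a≢0 relation = xorSum-periodic _ a≢0 λ c →
  cong (λ t → g (t ⊕ x))
       (trans (⊕-homo (lin-linear vs) c a) (trans (cong (lin vs c ⊕_) relation) (⊕-identityʳ _)))

Degree<⇒xorSum≡false : Degree< k g → xorSum k g ≡ false
Degree<⇒xorSum≡false {k} {g = g} deg = begin
  xorSum k g                       ≡⟨ xorSum-resp (λ c → cong g (sym (lin-basis c))) ⟩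
  xorSum k (g ∘ lin (basis k))     ≡⟨ xorSum-∘lin (basis k) g ⟩
  Δs (basis k) g (zeros k)         ≡⟨ Degree<⇒Δs≡false deg (basis k) (zeros k) ⟩
  false                            ∎

xorSum-off-zero : (g : F2^ (suc k) → Bool) → (∀ c → c ≢ zeros (suc k) → g c ≡ true) →
                  xorSum (suc k) g ≡ not (g (zeros (suc k)))
xorSum-off-zero {zero}  g g≡true =
  trans (cong (g (false ∷ []) xor_) (g≡true (true ∷ []) λ ())) (xor-comm _ true)
xorSum-off-zero {suc k} g g≡true = begin
  xorSum (suc k) (g ∘ (false ∷_)) xor xorSum (suc k) (g ∘ (true ∷_))
    ≡⟨ cong₂ _xor_ (xorSum-off-zero (g ∘ (false ∷_)) λ c c≢0 → g≡true (false ∷ c) (c≢0 ∘ cong tail))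
                   (trans (xorSum-resp (λ c → g≡true (true ∷ c) λ ()))
                          (xorSum-off-zero {k} (λ _ → true) λ _ _ → refl)) ⟩
  not (g (zeros (suc (suc k)))) xor false
    ≡⟨ xor-identityʳ _ ⟩
  not (g (zeros (suc (suc k))))
    ∎

-- Pigeonhole in F₂ᵏ

module Bit = Inverse 2↔Bool

encode : F2^ k → Fin (2 ^ k)
encode []      = Fin.zero
encode (b ∷ v) = combine (Bit.from b) (encode v)

decode : Fin (2 ^ k) → F2^ k
decode {zero}  _ = []
decode {suc k} i = Bit.to (proj₁ (remQuot {2} (2 ^ k) i)) ∷ decode (proj₂ (remQuot {2} (2 ^ k) i))

decode-encode : (v : F2^ k) → decode (encode v) ≡ v
decode-encode         []      = refl
decode-encode {suc k} (b ∷ v) = begin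
  decode (combine (Bit.from b) (encode v))
    ≡⟨ cong (λ q → Bit.to (proj₁ q) ∷ decode (proj₂ q)) (remQuot-combine {2} {2 ^ k} _ (encode v)) ⟩
  Bit.to (Bit.from b) ∷ decode (encode v)
    ≡⟨ cong₂ _∷_ (Bit.strictlyInverseˡ b) (decode-encode v) ⟩
  b ∷ v
    ∎

encode-decode : (i : Fin (2 ^ k)) → encode {k} (decode i) ≡ i
encode-decode {zero}  Fin.zero = refl
encode-decode {suc k} i =
  trans (cong₂ combine (Bit.strictlyInverseʳ (proj₁ q)) (encode-decode {k} (proj₂ q)))
        (combine-remQuot {2} (2 ^ k) i)
  where q = remQuot {2} (2 ^ k) i

_≟ᵛ_ : (x y : F2^ n) → Dec (x ≡ y)
_≟ᵛ_ = ≡-dec _≟_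

∃-F2^? : {P : F2^ k → Set} → (∀ c → Dec (P c)) → Dec (∃ P)
∃-F2^? {P = P} P? = map′ (λ (i , p) → decode i , p)
                         (λ (c , p) → encode c , subst P (sym (decode-encode c)) p)
                         (any? (P? ∘ decode))

linear-dependence : n < k → (vs : Vec (F2^ n) k) → ∃ λ a → a ≢ zeros k × lin vs a ≡ zeros n
linear-dependence {n} {k} n<k vs
  with pigeonhole (^-monoʳ-< 2 (s≤s (s≤s z≤n)) n<k) (encode ∘ lin vs ∘ decode)
... | i , j , i<j , same-code = decode i ⊕ decode j , distinct , relation
  where
  distinct : decode i ⊕ decode j ≢ zeros k
  distinct eq = <⇒≢ i<j (trans (sym (encode-decode {k} i))
                        (trans (cong encode (⊕≡zeros⇒≡ _ _ eq)) (encode-decode {k} j)))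
  relation : lin vs (decode i ⊕ decode j) ≡ zeros n
  relation = begin
    lin vs (decode i ⊕ decode j)             ≡⟨ ⊕-homo (lin-linear vs) (decode i) (decode j) ⟩
    lin vs (decode i) ⊕ lin vs (decode j)    ≡⟨ cong (_⊕ lin vs (decode j)) same-vector ⟩
    lin vs (decode j) ⊕ lin vs (decode j)    ≡⟨ ⊕-self _ ⟩
    zeros n                                  ∎
    where
    same-vector : lin vs (decode i) ≡ lin vs (decode j)
    same-vector = trans (sym (decode-encode _)) (trans (cong decode same-code) (decode-encode _))

nonzero-root : (g : F2^ (suc k) → Bool) → g (zeros (suc k)) ≡ false → Degree< (suc k) g →
               ∃ λ w → w ≢ zeros (suc k) × g w ≡ false
nonzero-root {k} g g0≡false deg with ∃-F2^? (λ w → ¬? (w ≟ᵛ zeros (suc k)) ×-dec (g w ≟ false))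
... | yes root    = root
... | no no-root  = case true≡false of λ ()
  where
  g≡true : ∀ c → c ≢ zeros (suc k) → g c ≡ true
  g≡true c c≢0 = ¬-not λ gc≡false → no-root (c , c≢0 , gc≡false)
  true≡false : true ≡ false
  true≡false = begin
    true                    ≡⟨ cong not (sym g0≡false) ⟩
    not (g (zeros (suc k))) ≡⟨ sym (xorSum-off-zero g g≡true) ⟩
    xorSum (suc k) g        ≡⟨ Degree<⇒xorSum≡false deg ⟩
    false                   ∎

Degree<-dimension : (g : F2^ k → Bool) → Degree< (suc k) g
Degree<-dimension {k} g = Δs≡false⇒Degree< λ vs x →
  let (a , a≢0 , relation) = linear-dependence (n<1+n k) vs
  in trans (sym (xorSum-flat vs g x)) (xorSum-dependent vs g x a≢0 relation)

-- Spans and hyperplanes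

InSpan : Vec (F2^ n) k → F2^ n → Set
InSpan hs y = ∃ λ c → lin hs c ≡ y

InSpan-⊕ : (hs : Vec (F2^ n) k) {y z : F2^ n} → InSpan hs y → InSpan hs z → InSpan hs (y ⊕ z)
InSpan-⊕ hs (c , refl) (d , refl) = c ⊕ d , ⊕-homo (lin-linear hs) c d

∈-allVecs : (c : F2^ k) → c ∈ allVecs k
∈-allVecs []          = here refl
∈-allVecs (false ∷ c) = ∈-++⁺ˡ (∈-map⁺ (false ∷_) (∈-allVecs c))
∈-allVecs (true ∷ c)  = ∈-++⁺ʳ (List.map (false ∷_) (allVecs _)) (∈-map⁺ (true ∷_) (∈-allVecs c))

==-refl : (x : F2^ n) → T (x == x)
==-refl []          = tt
==-refl (true ∷ x)  = ==-refl x
==-refl (false ∷ x) = ==-refl x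

==⇒≡ : (x y : F2^ n) → T (x == y) → x ≡ y
==⇒≡ []          []          _  = refl
==⇒≡ (true ∷ x)  (true ∷ y)  eq = cong (true ∷_) (==⇒≡ x y eq)
==⇒≡ (false ∷ x) (false ∷ y) eq = cong (false ∷_) (==⇒≡ x y eq)
==⇒≡ (true ∷ x)  (false ∷ y) ()
==⇒≡ (false ∷ x) (true ∷ y)  ()

inSpan-reflects : (hs : Vec (F2^ n) k) (y : F2^ n) → Reflects (InSpan hs y) (inSpan hs y)
inSpan-reflects {k = k} hs y = fromEquivalence
  (λ found → let (c , _ , c↦y) = find (any⁻ _ (allVecs k) found) in c , ==⇒≡ _ _ c↦y)
  (λ (c , c↦y) → any⁺ _ (lose (∈-allVecs c) (subst (λ t → T (lin hs c == t)) c↦y (==-refl (lin hs c)))))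

hyperplane-complement : (hs : Vec (F2^ (suc m)) m) → LinIndep hs → {y z : F2^ (suc m)} →
                        ¬ InSpan hs y → ¬ InSpan hs z → InSpan hs (y ⊕ z)
hyperplane-complement {m} hs independent {y} {z} y∉ z∉ =
  let (a , a≢0 , relation) = linear-dependence (n<1+n (suc m)) (z ∷ y ∷ hs) in from-relation a a≢0 relation
  where
  drop : (v u : F2^ (suc m)) → (false · v) ⊕ u ≡ u
  drop v u = trans (cong (_⊕ u) (·-zeroˡ v)) (⊕-identityˡ u)
  keep : (v u : F2^ (suc m)) → (true · v) ⊕ u ≡ v ⊕ u
  keep v u = cong (_⊕ u) (·-identityˡ v)
  from-relation : (a : F2^ (suc (suc m))) → a ≢ zeros _ → lin (z ∷ y ∷ hs) a ≡ zeros _ →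
                  InSpan hs (y ⊕ z)
  from-relation (false ∷ false ∷ d) a≢0 relation = ⊥-elim (a≢0 (cong (λ t → false ∷ false ∷ t)
    (independent d (trans (sym (trans (drop z _) (drop y _))) relation))))
  from-relation (true ∷ false ∷ d) _ relation = ⊥-elim (z∉ (d , sym (⊕≡zeros⇒≡ z _
    (trans (sym (trans (keep z _) (cong (z ⊕_) (drop y _)))) relation))))
  from-relation (false ∷ true ∷ d) _ relation = ⊥-elim (y∉ (d , sym (⊕≡zeros⇒≡ y _
    (trans (sym (trans (drop z _) (keep y _))) relation))))
  from-relation (true ∷ true ∷ d) _ relation = d , (begin
    lin hs d              ≡⟨ sym (⊕-cancelˡ y (lin hs d)) ⟩
    y ⊕ (y ⊕ lin hs d)    ≡⟨ cong (y ⊕_) (sym z≡y⊕h) ⟩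
    y ⊕ z                 ∎)
    where
    z≡y⊕h : z ≡ y ⊕ lin hs d
    z≡y⊕h = ⊕≡zeros⇒≡ z _ (trans (sym (trans (keep z _) (cong (z ⊕_) (keep y _)))) relation)

hyperplane-indicator-linear : (hs : Vec (F2^ (suc m)) m) → LinIndep hs → LinearForm (λ y → not (inSpan hs y))
hyperplane-indicator-linear hs independent = linearForm homo
  where
  in-span : ∀ {x} → InSpan hs x → not (inSpan hs x) ≡ false
  in-span x∈ = cong not (det (inSpan-reflects hs _) (ofʸ x∈))
  out-of-span : ∀ {x} → ¬ InSpan hs x → not (inSpan hs x) ≡ true
  out-of-span x∉ = cong not (det (inSpan-reflects hs _) (ofⁿ x∉))
  homo : ∀ y z → not (inSpan hs (y ⊕ z)) ≡ not (inSpan hs y) xor not (inSpan hs z)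
  homo y z with inSpan hs y | inSpan-reflects hs y | inSpan hs z | inSpan-reflects hs z
  ... | true  | ofʸ y∈ | true  | ofʸ z∈ = in-span (InSpan-⊕ hs y∈ z∈)
  ... | true  | ofʸ y∈ | false | ofⁿ z∉ =
    out-of-span λ y⊕z∈ → z∉ (subst (InSpan hs) (⊕-cancelˡ y z) (InSpan-⊕ hs y∈ y⊕z∈))
  ... | false | ofⁿ y∉ | true  | ofʸ z∈ =
    out-of-span λ y⊕z∈ → y∉ (subst (InSpan hs) (⊕-cancelʳ y z) (InSpan-⊕ hs y⊕z∈ z∈))
  ... | false | ofⁿ y∉ | false | ofⁿ z∉ = in-span (hyperplane-complement hs independent y∉ z∉)

coordinate-hyperplane : Vec (F2^ (suc k)) k
coordinate-hyperplane {k} = map (false ∷_) (basis k)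

lin-coordinate-hyperplane : (c : F2^ k) → lin coordinate-hyperplane c ≡ false ∷ c
lin-coordinate-hyperplane {k} c =
  trans (lin-map (linear λ _ _ → refl) (basis k) c) (cong (false ∷_) (lin-basis c))

coordinate-hyperplane-independent : LinIndep (coordinate-hyperplane {k})
coordinate-hyperplane-independent c c↦0 = cong tail (trans (sym (lin-coordinate-hyperplane c)) c↦0)

not-inSpan-coordinate-hyperplane : (u : F2^ (suc k)) → not (inSpan coordinate-hyperplane u) ≡ head u
not-inSpan-coordinate-hyperplane (false ∷ u) =
  cong not (det (inSpan-reflects coordinate-hyperplane (false ∷ u)) (ofʸ (u , lin-coordinate-hyperplane u)))
not-inSpan-coordinate-hyperplane (true ∷ u) = cong not (det (inSpan-reflects coordinate-hyperplane (true ∷ u))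
  (ofⁿ λ (d , d↦u) → case trans (sym (lin-coordinate-hyperplane d)) d↦u of λ ()))

-- The class E₃

parity : ℕ → Bool
parity zero    = false
parity (suc n) = not (parity n)

parity-+ : (m n : ℕ) → parity (m + n) ≡ parity m xor parity n
parity-+ zero    n = refl
parity-+ (suc m) n = trans (cong not (parity-+ m n)) (not-distribˡ-xor (parity m) (parity n))

parity≡false⇒even : (n : ℕ) → parity n ≡ false → 2 ∣ n
parity≡false⇒even zero          _  = divides 0 refl
parity≡false⇒even (suc (suc n)) eq =
  ∣m∣n⇒∣m+n ∣-refl (parity≡false⇒even n (trans (sym (not-involutive (parity n))) eq))

even⇒parity≡false : (n : ℕ) → 2 ∣ n → parity n ≡ false
even⇒parity≡false zero          _   = refl
even⇒parity≡false (suc zero)    (divides zero    ())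
even⇒parity≡false (suc zero)    (divides (suc q) ())
even⇒parity≡false (suc (suc n)) 2∣n =
  trans (not-involutive (parity n)) (even⇒parity≡false n (∣m+n∣m⇒∣n 2∣n ∣-refl))

length-filter-map : {A B : Set} {P : B → Set} (P? : ∀ b → Dec (P b)) (f : A → B) (xs : List A) →
                    length (filter P? (List.map f xs)) ≡ length (filter (P? ∘ f) xs)
length-filter-map P? f []       = refl
length-filter-map P? f (x ∷ xs) with does (P? (f x))
... | true  = cong suc (length-filter-map P? f xs)
... | false = length-filter-map P? f xs

parity-count : (g : F2^ k → Bool) → parity (length (filter (λ c → g c ≟ true) (allVecs k))) ≡ xorSum k g
parity-count {zero}  g with g []
... | true  = refl
... | false = refl
parity-count {suc k} g = begin
  parity (length (filter P? (List.map (false ∷_) vs ++ List.map (true ∷_) vs)))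
    ≡⟨ cong (parity ∘ length) (filter-++ P? (List.map (false ∷_) vs) _) ⟩
  parity (length (filter P? (List.map (false ∷_) vs) ++ filter P? (List.map (true ∷_) vs)))
    ≡⟨ cong parity (length-++ (filter P? (List.map (false ∷_) vs))) ⟩
  parity (length (filter P? (List.map (false ∷_) vs)) + length (filter P? (List.map (true ∷_) vs)))
    ≡⟨ parity-+ (length (filter P? (List.map (false ∷_) vs))) _ ⟩
  parity (length (filter P? (List.map (false ∷_) vs))) xor parity (length (filter P? (List.map (true ∷_) vs)))
    ≡⟨ cong₂ (λ s t → parity s xor parity t) (length-filter-map P? _ vs) (length-filter-map P? _ vs) ⟩
  parity (length (filter (P? ∘ (false ∷_)) vs)) xor parity (length (filter (P? ∘ (true ∷_)) vs))
    ≡⟨ cong₂ _xor_ (parity-count (g ∘ (false ∷_))) (parity-count (g ∘ (true ∷_))) ⟩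
  xorSum k (g ∘ (false ∷_)) xor xorSum k (g ∘ (true ∷_))
    ∎
  where
  P? = λ c → g c ≟ true
  vs = allVecs k

Degree<3⇒InE3 : (M : Matroid n) → Degree< 3 (elem M) → InE3 M
Degree<3⇒InE3 M deg k 3≤k vs _ = parity≡false⇒even _ (begin
  parity (countIn M vs)       ≡⟨ parity-count (elem M ∘ lin vs) ⟩
  xorSum k (elem M ∘ lin vs)  ≡⟨ xorSum-∘lin vs (elem M) ⟩
  Δs vs (elem M) (zeros _)    ≡⟨ Degree<⇒Δs≡false (Degree<-mono 3≤k deg) vs (zeros _) ⟩
  false                       ∎)

InE3⇒Δs≡false : (M : Matroid n) → InE3 M → 3 ≤ k → (vs : Vec (F2^ n) k) →
                Δs vs (elem M) (zeros n) ≡ false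
InE3⇒Δs≡false {n} {k} M e3 3≤k vs
  with ∃-F2^? (λ a → ¬? (a ≟ᵛ zeros k) ×-dec (lin vs a ≟ᵛ zeros n))
... | yes (a , a≢0 , relation) =
  trans (sym (xorSum-flat vs (elem M) (zeros n))) (xorSum-dependent vs (elem M) (zeros n) a≢0 relation)
... | no no-relation = begin
  Δs vs (elem M) (zeros n)    ≡⟨ sym (xorSum-∘lin vs (elem M)) ⟩
  xorSum k (elem M ∘ lin vs)  ≡⟨ sym (parity-count (elem M ∘ lin vs)) ⟩
  parity (countIn M vs)       ≡⟨ even⇒parity≡false _ (e3 k 3≤k vs independent) ⟩
  false                       ∎
  where
  independent : LinIndep vs
  independent a relation = decidable-stable (a ≟ᵛ zeros k) λ a≢0 → no-relation (a , a≢0 , relation)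

InE3⇒Degree<3 : (M : Matroid n) → InE3 M → Degree< 3 (elem M)
InE3⇒Degree<3 {n} M e3 = Δs≡false⇒Degree< λ vs x → begin
  Δs vs f x                                      ≡⟨ cong (Δs vs f) (sym (⊕-identityˡ x)) ⟩
  Δs vs f (zeros n ⊕ x)                          ≡⟨ sym (xor-cancelʳ _ (Δs vs f (zeros n))) ⟩
  Δ x (Δs vs f) (zeros n) xor Δs vs f (zeros n)  ≡⟨ cong₂ _xor_ (trans (sym (Δs-∷ʳ vs x (zeros n)))
                                                                       (InE3⇒Δs≡false M e3 3≤4 (vs ∷ʳ x)))
                                                                (InE3⇒Δs≡false M e3 ≤-refl vs) ⟩
  false                                          ∎
  where
  f = elem M
  3≤4 : 3 ≤ 4
  3≤4 = s≤s (s≤s (s≤s z≤n))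

-- Doubling and semidoubling

≅-refl : (M : Matroid n) → M ≅ M
≅-refl M = Aut⇒≅ {M = M} {M′ = M} Aut-id (λ _ → refl)

Degree<-≅ : {M : Matroid m} {M′ : Matroid n} → M ≅ M′ → Degree< d (elem M′) → Degree< d (elem M)
Degree<-≅ (A , _ , preserves) deg = Degree<-resp preserves (Degree<-∘ (lin-linear A) deg)

Degree<-≅⁻ : {M : Matroid m} {M′ : Matroid n} → M ≅ M′ → Degree< d (elem M) → Degree< d (elem M′)
Degree<-≅⁻ (A , (_ , surjective) , preserves) deg =
  Degree<-∘⁻ (lin-linear A) (λ y → let (x , hit) = surjective y in x , hit refl)
             (Degree<-resp (sym ∘ preserves) deg)

tail-linear : Linear (tail {n = n})
tail-linear = linear λ { (a ∷ x) (b ∷ y) → refl }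

head-linear : LinearForm (head {n = n})
head-linear = linearForm λ { (a ∷ x) (b ∷ y) → refl }

double-Degree<3 : (M : Matroid n) → Degree< 3 (elem M) → Degree< 3 (elem (double M))
double-Degree<3 M deg = Degree<-resp (λ { (_ ∷ _) → refl }) (Degree<-∘ tail-linear deg)

semidouble-∷ : (M : Matroid (suc m)) (hs : Vec (F2^ (suc m)) m) (ind : LinIndep hs) (b : Bool) (u : F2^ (suc m)) →
               elem (semidouble M hs ind) (b ∷ u) ≡ elem M u xor (b ∧ not (inSpan hs u))
semidouble-∷ M hs ind false u = sym (xor-identityʳ _)
semidouble-∷ M hs ind true  u = refl

semidouble-Degree<3 : (M : Matroid (suc m)) (hs : Vec (F2^ (suc m)) m) (ind : LinIndep hs) →
                      Degree< 3 (elem M) → Degree< 3 (elem (semidouble M hs ind))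
semidouble-Degree<3 M hs ind deg =
  Degree<-resp (λ { (b ∷ u) → sym (semidouble-∷ M hs ind b u) })
    (Degree<-xor (Degree<-∘ tail-linear deg)
                 (LinearForm-∧-Degree< head-linear
                   (Degree<-∘ tail-linear (LinearForm⇒Degree<2 (hyperplane-indicator-linear hs ind)))))

Seq⇒Degree<3 : {M : Matroid n} → Seq M → Degree< 3 (elem M)
Seq⇒Degree<3 (start M₀)                   = Degree<-dimension (elem M₀)
Seq⇒Degree<3 (dbl {M = M} {M′} s iso)         =
  Degree<-≅ {M = M′} {M′ = double M} iso (double-Degree<3 M (Seq⇒Degree<3 s))
Seq⇒Degree<3 (sdbl {M = M} {M′} s hs ind iso) =
  Degree<-≅ {M = M′} {M′ = semidouble M hs ind} iso (semidouble-Degree<3 M hs ind (Seq⇒Degree<3 s))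

data Predecessor (M : Matroid (suc (suc m))) : Set where
  doubling     : (M₀ : Matroid (suc m)) → Degree< 3 (elem M₀) → M ≅ double M₀ → Predecessor M
  semidoubling : (M₀ : Matroid (suc m)) → Degree< 3 (elem M₀) →
                 (hs : Vec (F2^ (suc m)) m) (ind : LinIndep hs) → M ≅ semidouble M₀ hs ind → Predecessor M

predecessor-via : {M : Matroid (suc (suc m))} (P : Aut (suc (suc m))) →
                  Degree< 3 (elem M) → elem M (from P e₁) ≡ false → Predecessor M
predecessor-via {m} {M} P deg e₁∉E = case ∃-F2^? (λ y → ℓ y ≟ true) of λ where
    (no ℓ≢true)         → as-doubling ℓ≢true
    (yes (y , ℓy≡true)) → as-semidoubling y ℓy≡true
  where
  f′ : F2^ (suc (suc m)) → Bool
  f′ = elem M ∘ from P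
  deg′ : Degree< 3 f′
  deg′ = Degree<-∘ (from-linear P) deg
  f′0≡false : f′ (zeros _) ≡ false
  f′0≡false = trans (cong (elem M) (Linear-zeros (from-linear P))) (elem0 M)
  f₀ ℓ : F2^ (suc m) → Bool
  f₀ y = f′ (false ∷ y)
  ℓ  y = Δ e₁ f′ (false ∷ y)
  f′-split : ∀ b y → f′ (b ∷ y) ≡ f₀ y xor (b ∧ ℓ y)
  f′-split = split-head f′
  deg₀ : Degree< 3 f₀
  deg₀ = Degree<-∘ (linear λ _ _ → refl) deg′
  ℓ-linear : LinearForm ℓ
  ℓ-linear = Degree<2⇒LinearForm (Degree<-∘ (linear λ _ _ → refl) (Degree<-Δ deg′ e₁))
    (cong₂ _xor_ (trans (cong (f′ ∘ (true ∷_)) (⊕-self (zeros _))) e₁∉E) f′0≡false)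

  as-doubling : ¬ ∃ (λ y → ℓ y ≡ true) → Predecessor M
  as-doubling ℓ≢true =
    doubling M₀ deg₀ (Aut⇒≅ {M = M} {M′ = double M₀} P λ { (b ∷ y) → sym (f′≡f₀ b y) })
    where
    M₀ : Matroid (suc m)
    M₀ = record { elem = f₀ ; elem0 = f′0≡false }
    f′≡f₀ : ∀ b y → f′ (b ∷ y) ≡ f₀ y
    f′≡f₀ b y = begin
      f′ (b ∷ y)            ≡⟨ f′-split b y ⟩
      f₀ y xor (b ∧ ℓ y)    ≡⟨ cong (λ t → f₀ y xor (b ∧ t)) ℓy≡false ⟩
      f₀ y xor (b ∧ false)  ≡⟨ cong (f₀ y xor_) (∧-zeroʳ b) ⟩
      f₀ y xor false        ≡⟨ xor-identityʳ (f₀ y) ⟩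
      f₀ y                  ∎
      where
      ℓy≡false : ℓ y ≡ false
      ℓy≡false = ¬-not λ ℓy≡true → ℓ≢true (y , ℓy≡true)

  as-semidoubling : (y : F2^ (suc m)) → ℓ y ≡ true → Predecessor M
  as-semidoubling y ℓy≡true = semidoubling M₀ (Degree<-∘ (to-linear ψ) deg₀) H H-independent
    (Aut⇒≅ {M = M} {M′ = semidouble M₀ H H-independent} (Aut-lift (ψ ⁻¹) ∘ᴬ P)
           λ { (b ∷ u) → M₁≡f′ b u })
    where
    H : Vec (F2^ (suc m)) m
    H = coordinate-hyperplane
    H-independent : LinIndep H
    H-independent = coordinate-hyperplane-independent
    ψ : Aut (suc m)
    ψ = proj₁ (Aut-straighten ℓ-linear y ℓy≡true)
    ℓ∘ψ≡head : ∀ u → ℓ (to ψ u) ≡ head u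
    ℓ∘ψ≡head = proj₂ (Aut-straighten ℓ-linear y ℓy≡true)
    M₀ : Matroid (suc m)
    M₀ = record { elem  = f₀ ∘ to ψ
                ; elem0 = trans (cong f₀ (Linear-zeros (to-linear ψ))) f′0≡false }
    M₁≡f′ : ∀ b u → elem (semidouble M₀ H H-independent) (b ∷ u) ≡ f′ (b ∷ to ψ u)
    M₁≡f′ b u = begin
      elem (semidouble M₀ H H-independent) (b ∷ u)
        ≡⟨ semidouble-∷ M₀ H H-independent b u ⟩
      f₀ (to ψ u) xor (b ∧ not (inSpan H u))
        ≡⟨ cong (λ t → f₀ (to ψ u) xor (b ∧ t)) H-indicator ⟩
      f₀ (to ψ u) xor (b ∧ ℓ (to ψ u))
        ≡⟨ sym (f′-split b (to ψ u)) ⟩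
      f′ (b ∷ to ψ u)
        ∎
      where
      H-indicator : not (inSpan H u) ≡ ℓ (to ψ u)
      H-indicator = trans (not-inSpan-coordinate-hyperplane u) (sym (ℓ∘ψ≡head u))

predecessor : (M : Matroid (suc (suc (suc m)))) → Degree< 3 (elem M) → Predecessor M
predecessor M deg =
  let (w , w≢0 , w∉E) = nonzero-root (elem M) (elem0 M) (Degree<-mono (s≤s (s≤s (s≤s z≤n))) deg)
      (P , Pw≡e₁)     = Aut-to-e₁ w w≢0
  in predecessor-via P deg (begin
       elem M (from P e₁)        ≡⟨ cong (elem M ∘ from P) (sym Pw≡e₁) ⟩
       elem M (from P (to P w))  ≡⟨ cong (elem M) (from-to P w) ⟩
       elem M w                  ≡⟨ w∉E ⟩
       false                     ∎)

Degree<3⇒Seq : (M : Matroid (suc (suc m))) → Degree< 3 (elem M) → Seq M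
Degree<3⇒Seq {zero}  M _   = start M
Degree<3⇒Seq {suc m} M deg with predecessor M deg
... | doubling     M₀ deg₀ iso        = dbl  (Degree<3⇒Seq M₀ deg₀) iso
... | semidoubling M₀ deg₀ hs ind iso = sdbl (Degree<3⇒Seq M₀ deg₀) hs ind iso

corollary3p4 : (n : ℕ) → 2 ≤ n → (M : Matroid n)
             → (InE3 M → ArisesFrom2 M) × (ArisesFrom2 M → InE3 M)
corollary3p4 (suc (suc m)) (s≤s (s≤s z≤n)) M = forward , backward
  where
  forward : InE3 M → ArisesFrom2 M
  forward e3 = suc (suc m) , M , Degree<3⇒Seq M (InE3⇒Degree<3 M e3) , ≅-refl M
  backward : ArisesFrom2 M → InE3 M
  backward (_ , M′ , seq , M′≅M) =
    Degree<3⇒InE3 M (Degree<-≅⁻ {M = M′} {M′ = M} M′≅M (Seq⇒Degree<3 seq))
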